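{- Let $D$ be an in-semicomplete digraph, let $k$ be a positive integer, and let $\mathcal{P}$ be a path partition of $D$. Then there exists a path partition $\mathcal{Q}$ of $D$ such that one of the following holds: (i) $|\mathcal{Q}|_k < |\mathcal{P}|_k$ and $e(\mathcal{Q}) \subsetneq e(\mathcal{P})$; or (ii) $|\mathcal{Q}|_k = |\mathcal{P}|_k$, $e(\mathcal{Q}) \subseteq e(\mathcal{P})$, $e(\mathcal{Q})$ is a stable set of $D$, and every partial $k$-coloring of $D$ orthogonal to $\mathcal{Q}$ is also orthogonal to $\mathcal{P}$.
   Context: Digraphs are finite, without loops or parallel arcs (directed 2-cycles allowed). Vertices $u,v$ are adjacent if $uv$ or $vu$ is an arc. A digraph is semicomplete if every two distinct vertices are adjacent; $D$ is (locally) in-semicomplete if for every vertex $v$ the in-neighborhood $\{u : uv \in A(D)\}$ induces a semicomplete digraph. A path is a nonempty sequence $v_1\dots v_\ell$ of distinct vertices with $v_iv_{i+1}\in A(D)$; its order is $|P|=\ell$ and its end is $e(P)=v_\ell$. A path partition of $D$ is a set of vertex-disjoint paths covering $V(D)$; for a set $\mathcal{P}$ of paths, $e(\mathcal{P})=\{e(P):P\in\mathcal{P}\}$. The $k$-norm is $|\mathcal{P}|_k=\sum_{P\in\mathcal{P}}\min\{|P|,k\}$. A set of vertices is stable if its vertices are pairwise nonadjacent. A partial $k$-coloring of $D$ is a collection of $k$ pairwise disjoint (possibly empty) stable sets (color classes). A path partition $\mathcal{P}$ and a partial $k$-coloring $\mathcal{C}$ are orthogonal if each path $P\in\mathcal{P}$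 meets $\min\{|P|,k\}$ distinct color classes of $\mathcal{C}$. -}

module Defs where

open import Data.Nat using (ℕ; zero; suc; _+_; _⊓_; _≤_; _<_)
open import Data.Bool using (Bool; true; false; _∨_; if_then_else_)
open import Data.Fin using (Fin)
open import Data.List using (List; []; _∷_; length; map; concat; allFin)
open import Data.Nat.ListAction using (sum)
open import Data.Bool.ListAction using (any)
open import Data.List.Membership.Propositional using (_∈_)
open import Data.List.Relation.Unary.Unique.Propositional using (Unique)
open import Data.List.Relation.Unary.All using (All)
open import Data.Product using (Σ; _×_; ∃; ∃-syntax)
open import Relation.Binary.PropositionalEquality using (_≡_; _≢_)
open import Relation.Nullary using (¬_)
open import Data.Unit using (⊤)

-- A digraph on vertex set Fin n; arcs given by a Boolean relation
-- (so no parallel arcs), with no loops. Directed 2-cycles are allowed.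
record Digraph : Set where
  field
    n        : ℕ
    arc      : Fin n → Fin n → Bool
    loopless : ∀ v → arc v v ≡ false
open Digraph public

Vertex : Digraph → Set
Vertex D = Fin (n D)

Arc : (D : Digraph) → Vertex D → Vertex D → Set
Arc D u v = arc D u v ≡ true

Adjacent : (D : Digraph) → Vertex D → Vertex D → Set
Adjacent D u v = (arc D u v ∨ arc D v u) ≡ true

InSemicomplete : Digraph → Set
InSemicomplete D = ∀ v u w → Arc D u v → Arc D w v → u ≢ w → Adjacent D u w

Linked : (D : Digraph) → List (Vertex D) → Set
Linked D []            = ⊤
Linked D (x ∷ [])      = ⊤
Linked D (x ∷ y ∷ xs)  = Arc D x y × Linked D (y ∷ xs)

record Path (D : Digraph) : Set where
  constructor mkPath
  field
    start : Vertex D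
    rest  : List (Vertex D)
    distinct : Unique (start ∷ rest)
    linked   : Linked D (start ∷ rest)
open Path public

verts : {D : Digraph} → Path D → List (Vertex D)
verts P = start P ∷ rest P

order : {D : Digraph} → Path D → ℕ
order P = length (verts P)

lastOf : {A : Set} → A → List A → A
lastOf x []       = x
lastOf x (y ∷ ys) = lastOf y ys

end : {D : Digraph} → Path D → Vertex D
end P = lastOf (start P) (rest P)

-- a path partition: vertex-disjoint paths covering V(D)
-- (disjointness of the paths = no vertex repeated in the concatenation)
IsPathPartition : (D : Digraph) → List (Path D) → Set
IsPathPartition D 𝒫 =
  Unique (concat (map verts 𝒫)) × (∀ (v : Vertex D) → v ∈ concat (map verts 𝒫))

Ends : {D : Digraph} → List (Path D) → Vertex D → Set
Ends {D} 𝒫 v = Σ (Path D) (λ P → P ∈ 𝒫 × end P ≡ v)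

SubsetOf : (D : Digraph) → (Vertex D → Set) → (Vertex D → Set) → Set
SubsetOf D S T = ∀ (v : Vertex D) → S v → T v

ProperSubsetOf : (D : Digraph) → (Vertex D → Set) → (Vertex D → Set) → Set
ProperSubsetOf D S T = SubsetOf D S T × (Σ (Vertex D) (λ v → T v × ¬ S v))

norm : {D : Digraph} → ℕ → List (Path D) → ℕ
norm k 𝒫 = sum (map (λ P → order P ⊓ k) 𝒫)

Stable : (D : Digraph) → (Vertex D → Set) → Set
Stable D S = ∀ u v → S u → S v → ¬ Adjacent D u v

record PartialColoring (D : Digraph) (k : ℕ) : Set where
  field
    class    : Fin k → Vertex D → Bool
    stable   : ∀ i → Stable D (λ v → class i v ≡ true)
    disjoint : ∀ i j v → class i v ≡ true → class j v ≡ true → i ≡ j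
open PartialColoring public

countTrue : List Bool → ℕ
countTrue []           = 0
countTrue (true ∷ bs)  = suc (countTrue bs)
countTrue (false ∷ bs) = countTrue bs

classesMet : {D : Digraph} {k : ℕ} → PartialColoring D k → Path D → ℕ
classesMet {k = k} C P = countTrue (map (λ i → any (class C i) (verts P)) (allFin k))

Orthogonal : {D : Digraph} {k : ℕ} → List (Path D) → PartialColoring D k → Set
Orthogonal {k = k} 𝒫 C = All (λ P → classesMet C P ≡ order P ⊓ k) 𝒫

-- If the ends u, v of two paths P, Q of a partition are joined by an arc uv, then P and Q can
-- be merged into one path on V(P) ∪ V(Q) that still ends at v: read both backwards from v and
-- interleave them, which is possible because any two in-neighbours of a vertex are adjacent.
-- Merging never increases the k-norm and loses the end u.  If the norm drops we are in case (i).
-- Otherwise min(|R|,k) = min(|P|,k) + min(|Q|,k) for the merged path R, and P, Q together meet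
-- every class that R meets, so a colouring orthogonal to the new partition meets min(|P|,k)
-- classes on P and min(|Q|,k) on Q.  We then continue with fewer paths until the ends are
-- stable, which is case (ii).
module Submission where

open import Defs
open import Data.Nat using (ℕ; suc; _+_; _⊓_; _≤_; _<_; z≤n; s≤s)
open import Data.Nat.Properties
  using (≤-trans; ≤-reflexive; ≤-antisym; m≤n⇒m≤1+n; n≤1+n; m≤n+m; m≤m+n; m≤n⇒m<n∨m≡n; +-suc; +-assoc;
         +-mono-≤; +-monoˡ-≤; +-monoʳ-≤; +-cancelˡ-≤; +-cancelʳ-≤; +-cancelʳ-≡;
         ⊓-glb; ⊓-monoʳ-≤; m⊓n≤n; +-distribˡ-⊓; +-distribʳ-⊓; module ≤-Reasoning)
open import Data.Nat.Induction using (<-wellFounded)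
open import Data.Nat.ListAction.Properties using (sum-↭)
open import Data.Bool using (Bool; true; false; _∨_; _≟_)
open import Data.Bool.Properties using (∨-assoc; ∨-comm; ∨-isCommutativeMonoid; ¬-not)
open import Data.Bool.ListAction using (any)
open import Data.List using (List; []; _∷_; _++_; [_]; length; map; concat; allFin)
open import Data.List.Properties using (++-identityʳ; ++-assoc; length-++; length-tabulate; map-cong)
open import Data.List.Membership.Propositional using (_∈_; find; lose)
open import Data.List.Membership.Propositional.Properties using (∈-++⁺ʳ; ∈-∃++; ∈-concat⁺′; ∈-map⁺)
open import Data.List.Relation.Unary.Any using (here; there; any?)
open import Data.List.Relation.Unary.All using (All; []; _∷_; universal)
import Data.List.Relation.Unary.All as All
import Data.List.Relation.Unary.All.Properties as All
open import Data.List.Relation.Unary.AllPairs using ([]; _∷_)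
open import Data.List.Relation.Unary.Unique.Propositional using (Unique)
open import Data.List.Relation.Unary.Unique.Propositional.Properties using (allFin⁺)
open import Data.List.Relation.Binary.Disjoint.Propositional using (Disjoint; contractᵣ)
import Data.List.Relation.Binary.Disjoint.Propositional.Properties as Disjoint
open import Data.List.Relation.Binary.Permutation.Propositional
  using (_↭_; ↭-refl; ↭-sym; ↭-trans; ↭-reflexive; ↭⇒↭ₛ; prep; swap)
open import Data.List.Relation.Binary.Permutation.Propositional.Properties
  using (∈-resp-↭; All-resp-↭; ↭-length; ++⁺ˡ; ++⁺ʳ; ++⁺; shift; shifts; ++-comm; map⁺)
import Data.List.Relation.Binary.Permutation.Setoid.Properties as PermutationSetoid
open import Data.Product using (Σ-syntax; ∃-syntax; _×_; _,_)
open import Data.Sum using (_⊎_; inj₁; inj₂)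
open import Data.Unit using (tt)
open import Function using (_∘_)
open import Induction.WellFounded using (Acc; acc)
open import Relation.Nullary using (¬_; yes; no)
open import Relation.Binary.PropositionalEquality
  using (_≡_; refl; sym; trans; cong; subst; setoid)

private
  variable
    A B : Set

Unique-resp-↭ : {xs ys : List A} → xs ↭ ys → Unique xs → Unique ys
Unique-resp-↭ {A} p = PermutationSetoid.Unique-resp-↭ (setoid A) (↭⇒↭ₛ p)

Unique-++⁻ˡ : (xs : List A) {ys : List A} → Unique (xs ++ ys) → Unique xs
Unique-++⁻ˡ []       _         = []
Unique-++⁻ˡ (x ∷ xs) (x∉ ∷ u) = All.++⁻ˡ xs x∉ ∷ Unique-++⁻ˡ xs u

Unique-++⇒Disjoint : (xs : List A) {ys : List A} → Unique (xs ++ ys) → Disjoint xs ys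
Unique-++⇒Disjoint (x ∷ xs) (x∉ ∷ _) (here refl , v∈ys) = All.lookup x∉ (∈-++⁺ʳ xs v∈ys) refl
Unique-++⇒Disjoint (x ∷ xs) (_  ∷ u) (there v∈xs , v∈ys) = Unique-++⇒Disjoint xs u (v∈xs , v∈ys)

concatMap-↭ : (f : A → List B) {xs ys : List A} → xs ↭ ys → concat (map f xs) ↭ concat (map f ys)
concatMap-↭ f (_↭_.refl)     = ↭-refl
concatMap-↭ f (prep x p)     = ++⁺ˡ (f x) (concatMap-↭ f p)
concatMap-↭ f (swap x y p)   = ↭-trans (shifts (f x) (f y)) (++⁺ˡ (f y) (++⁺ˡ (f x) (concatMap-↭ f p)))
concatMap-↭ f (_↭_.trans p q) = ↭-trans (concatMap-↭ f p) (concatMap-↭ f q)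

∈⇒↭∷ : {x : A} {xs : List A} → x ∈ xs → ∃[ ys ] (xs ↭ x ∷ ys)
∈⇒↭∷ x∈xs with ys , zs , refl ← ∈-∃++ x∈xs = ys ++ zs , shift _ ys zs

lastOf-∈ : (x : A) (xs : List A) → lastOf x xs ∈ x ∷ xs
lastOf-∈ x []       = here refl
lastOf-∈ x (y ∷ ys) = there (lastOf-∈ y ys)

_ᵒᵖ : Digraph → Digraph
D ᵒᵖ = record { n = n D ; arc = λ u v → arc D v u ; loopless = loopless D }

reverseOnto : A → List A → List A → List A
reverseOnto x []       zs = zs
reverseOnto x (y ∷ ys) zs = reverseOnto y ys (x ∷ zs)

reverseOnto-↭ : (x : A) (ys zs : List A) → lastOf x ys ∷ reverseOnto x ys zs ↭ x ∷ ys ++ zs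
reverseOnto-↭ x []       zs = ↭-refl
reverseOnto-↭ x (y ∷ ys) zs = ↭-trans (reverseOnto-↭ y ys (x ∷ zs)) (shift x (y ∷ ys) zs)

lastOf-reverseOnto : (x : A) (ys zs : List A) → lastOf (lastOf x ys) (reverseOnto x ys zs) ≡ lastOf x zs
lastOf-reverseOnto x []       zs = refl
lastOf-reverseOnto x (y ∷ ys) zs = lastOf-reverseOnto y ys (x ∷ zs)

Linked-reverseOnto : {D : Digraph} (x : Vertex D) (ys zs : List (Vertex D)) →
  Linked D (x ∷ ys) → Linked (D ᵒᵖ) (x ∷ zs) → Linked (D ᵒᵖ) (lastOf x ys ∷ reverseOnto x ys zs)
Linked-reverseOnto x []       zs _          l = l
Linked-reverseOnto x (y ∷ ys) zs (xy , lys) l = Linked-reverseOnto y ys (x ∷ zs) lys (xy , l)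

module _ {D : Digraph} (P : Path D) where

  private
    reversed↭ : lastOf (start P) (rest P) ∷ reverseOnto (start P) (rest P) [] ↭ verts P
    reversed↭ = ↭-trans (reverseOnto-↭ (start P) (rest P) [])
                        (↭-reflexive (cong (start P ∷_) (++-identityʳ (rest P))))

  reversePath : Path (D ᵒᵖ)
  reversePath = mkPath (end P) (reverseOnto (start P) (rest P) [])
    (Unique-resp-↭ (↭-sym reversed↭) (distinct P))
    (Linked-reverseOnto (start P) (rest P) [] (linked P) tt)

  verts-reversePath : verts reversePath ↭ verts P
  verts-reversePath = reversed↭

  end-reversePath : end reversePath ≡ start P
  end-reversePath = lastOf-reverseOnto (start P) (rest P) []

module _ {D : Digraph} (isc : InSemicomplete D) where

  -- The lists are paths of D read backwards from their ends x and y.  The next vertex after y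
  -- is x or the predecessor z of y, whichever has an arc into the other: both are in-neighbours
  -- of y, hence adjacent.
  mergeBackward : ∀ x as y bs → Disjoint (x ∷ as) (y ∷ bs) →
    Linked (D ᵒᵖ) (x ∷ as) → Linked (D ᵒᵖ) (y ∷ bs) → Arc D x y →
    Σ[ rs ∈ List (Vertex D) ] Linked (D ᵒᵖ) (y ∷ rs) × (y ∷ rs ↭ (x ∷ as) ++ y ∷ bs)
  mergeBackward x as y [] _ lx _ xy = x ∷ as , (xy , lx) , ++-comm [ y ] (x ∷ as)
  mergeBackward x as y (z ∷ bs) dj lx (zy , lz) xy
    with arc D x z in xz | isc y x z xy zy (λ x≡z → dj (here refl , there (here x≡z)))
  ... | true | _ =
    let rs , l , p = mergeBackward x as z bs (contractᵣ dj) lx lz xz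
    in z ∷ rs , (zy , l) , ↭-trans (prep y p) (↭-sym (shift y (x ∷ as) (z ∷ bs)))
  ... | false | zx =
    let rs , l , p = mergeBackward z bs x as (Disjoint.sym (contractᵣ dj)) lz lx zx
    in x ∷ rs , (xy , l) ,
       ↭-trans (prep y (↭-trans p (++-comm (z ∷ bs) (x ∷ as)))) (↭-sym (shift y (x ∷ as) (z ∷ bs)))

  mergePaths : (P Q : Path D) → Unique (verts P ++ verts Q) → Arc D (end P) (end Q) →
    Σ[ R ∈ Path D ] (verts R ↭ verts P ++ verts Q) × (end R ≡ end Q)
  mergePaths P Q uPQ arcPQ =
    forwards (mergeBackward (end P) (rest P′) (end Q) (rest Q′) P′#Q′ (linked P′) (linked Q′) arcPQ)
    where
    P′ Q′ : Path (D ᵒᵖ)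
    P′ = reversePath P
    Q′ = reversePath Q
    P′↭P : verts P′ ++ verts Q′ ↭ verts P ++ verts Q
    P′↭P = ++⁺ (verts-reversePath P) (verts-reversePath Q)
    P′#Q′ : Disjoint (verts P′) (verts Q′)
    P′#Q′ (v∈P′ , v∈Q′) = Unique-++⇒Disjoint (verts P) uPQ
      (∈-resp-↭ (verts-reversePath P) v∈P′ , ∈-resp-↭ (verts-reversePath Q) v∈Q′)
    forwards : Σ[ rs ∈ List (Vertex D) ] Linked (D ᵒᵖ) (end Q ∷ rs) × (end Q ∷ rs ↭ verts P′ ++ verts Q′) →
      Σ[ R ∈ Path D ] (verts R ↭ verts P ++ verts Q) × (end R ≡ end Q)
    forwards (rs , linked-rs , rs↭) =
      reversePath backward , ↭-trans (verts-reversePath backward) backward↭ , end-reversePath backward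
      where
      backward↭ : end Q ∷ rs ↭ verts P ++ verts Q
      backward↭ = ↭-trans rs↭ P′↭P
      backward : Path (D ᵒᵖ)
      backward = mkPath (end Q) rs (Unique-resp-↭ (↭-sym backward↭) uPQ) linked-rs

countTrue-map-≤-length : (f : A → Bool) (xs : List A) → countTrue (map f xs) ≤ length xs
countTrue-map-≤-length f []       = z≤n
countTrue-map-≤-length f (x ∷ xs) with f x
... | true  = s≤s (countTrue-map-≤-length f xs)
... | false = m≤n⇒m≤1+n (countTrue-map-≤-length f xs)

countTrue-map-≡0 : {f : A → Bool} {xs : List A} → All (λ x → f x ≡ false) xs → countTrue (map f xs) ≡ 0
countTrue-map-≡0 []         = refl
countTrue-map-≡0 (fx ∷ fxs) rewrite fx = countTrue-map-≡0 fxs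

countTrue-map-≤1 : (f : A → Bool) {xs : List A} → Unique xs →
  (∀ x y → f x ≡ true → f y ≡ true → x ≡ y) → countTrue (map f xs) ≤ 1
countTrue-map-≤1 f []                 _   = z≤n
countTrue-map-≤1 f {x ∷ xs} (x∉ ∷ u) one with f x in fx
... | true  = ≤-reflexive (cong suc (countTrue-map-≡0 (All.map (λ x≢y → ¬-not (x≢y ∘ one x _ fx)) x∉)))
... | false = countTrue-map-≤1 f u one

countTrue-map-∨ : (f g : A → Bool) (xs : List A) →
  countTrue (map (λ x → f x ∨ g x) xs) ≤ countTrue (map f xs) + countTrue (map g xs)
countTrue-map-∨ f g [] = z≤n
countTrue-map-∨ f g (x ∷ xs) with f x | g x
... | true  | true  = s≤s (≤-trans (countTrue-map-∨ f g xs) (+-monoʳ-≤ (countTrue (map f xs)) (n≤1+n _)))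
... | true  | false = s≤s (countTrue-map-∨ f g xs)
... | false | true  = ≤-trans (s≤s (countTrue-map-∨ f g xs)) (≤-reflexive (sym (+-suc _ _)))
... | false | false = countTrue-map-∨ f g xs

any-↭ : (p : A → Bool) {xs ys : List A} → xs ↭ ys → any p xs ≡ any p ys
any-↭ p xs↭ys = PermutationSetoid.foldr-commMonoid (setoid Bool) ∨-isCommutativeMonoid (↭⇒↭ₛ (map⁺ p xs↭ys))

any-++ : (p : A → Bool) (xs ys : List A) → any p (xs ++ ys) ≡ any p xs ∨ any p ys
any-++ p []       ys = refl
any-++ p (x ∷ xs) ys = trans (cong (p x ∨_) (any-++ p xs ys)) (sym (∨-assoc (p x) (any p xs) (any p ys)))

module _ {D : Digraph} {k : ℕ} (C : PartialColoring D k) where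

  classesMetIn : List (Vertex D) → ℕ
  classesMetIn vs = countTrue (map (λ i → any (class C i) vs) (allFin k))

  classesMetIn-≤-length : (vs : List (Vertex D)) → classesMetIn vs ≤ length vs
  classesMetIn-≤-length []       = ≤-reflexive (countTrue-map-≡0 (universal (λ _ → refl) (allFin k)))
  classesMetIn-≤-length (v ∷ vs) =
    ≤-trans (countTrue-map-∨ (λ i → class C i v) (λ i → any (class C i) vs) (allFin k))
            (+-mono-≤ (countTrue-map-≤1 (λ i → class C i v) (allFin⁺ k) (λ i j → disjoint C i j v))
                      (classesMetIn-≤-length vs))

  classesMetIn-≤-k : (vs : List (Vertex D)) → classesMetIn vs ≤ k
  classesMetIn-≤-k vs = ≤-trans (countTrue-map-≤-length _ (allFin k)) (≤-reflexive (length-tabulate _))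

  classesMet-≤ : (P : Path D) → classesMet C P ≤ order P ⊓ k
  classesMet-≤ P = ⊓-glb (classesMetIn-≤-length (verts P)) (classesMetIn-≤-k (verts P))

  classesMetIn-↭ : {xs ys : List (Vertex D)} → xs ↭ ys → classesMetIn xs ≡ classesMetIn ys
  classesMetIn-↭ xs↭ys = cong countTrue (map-cong (λ i → any-↭ (class C i) xs↭ys) (allFin k))

  classesMetIn-++ : (xs ys : List (Vertex D)) → classesMetIn (xs ++ ys) ≤ classesMetIn xs + classesMetIn ys
  classesMetIn-++ xs ys =
    subst (_≤ classesMetIn xs + classesMetIn ys)
          (cong countTrue (map-cong (λ i → sym (any-++ (class C i) xs ys)) (allFin k)))
          (countTrue-map-∨ _ _ (allFin k))

⊓-subadditive : ∀ a b k → (a + b) ⊓ k ≤ a ⊓ k + b ⊓ k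
⊓-subadditive a b k = subst ((a + b) ⊓ k ≤_) (sym (+-distribʳ-⊓ (b ⊓ k) a k)) (⊓-glb ≤a+b⊓k ≤k+b⊓k)
  where
  ≤a+b⊓k : (a + b) ⊓ k ≤ a + b ⊓ k
  ≤a+b⊓k = subst ((a + b) ⊓ k ≤_) (sym (+-distribˡ-⊓ a b k))
                 (⊓-monoʳ-≤ (a + b) (m≤n+m k a))
  ≤k+b⊓k : (a + b) ⊓ k ≤ k + b ⊓ k
  ≤k+b⊓k = ≤-trans (m⊓n≤n (a + b) k) (m≤m+n k (b ⊓ k))

+-squeeze : ∀ {a b c d} → a ≤ c → b ≤ d → c + d ≤ a + b → a ≡ c × b ≡ d
+-squeeze {a} {b} {c} {d} a≤c b≤d c+d≤a+b =
  ≤-antisym a≤c (+-cancelʳ-≤ d c a (≤-trans c+d≤a+b (+-monoʳ-≤ a b≤d))) ,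
  ≤-antisym b≤d (+-cancelˡ-≤ c d b (≤-trans c+d≤a+b (+-monoˡ-≤ b a≤c)))

module _ {D : Digraph} where

  Adjacent-sym : ∀ u v → Adjacent D u v → Adjacent D v u
  Adjacent-sym u v = trans (∨-comm (arc D v u) (arc D u v))

  Arc-irrefl : ∀ {u} → ¬ Arc D u u
  Arc-irrefl {u} uu with () ← trans (sym uu) (loopless D u)

  Adjacent-irrefl : ∀ u → ¬ Adjacent D u u
  Adjacent-irrefl u uu rewrite loopless D u with () ← uu

  Adjacent⇒Arc : ∀ u v → Adjacent D u v → Arc D u v ⊎ Arc D v u
  Adjacent⇒Arc u v uv with arc D u v
  ... | true  = inj₁ refl
  ... | false = inj₂ uv

  record ArcBetweenEnds (𝒫 : List (Path D)) : Set where
    field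
      P Q    : Path D
      others : List (Path D)
      split  : 𝒫 ↭ P ∷ Q ∷ others
      arcPQ  : Arc D (end P) (end Q)

  Stable-∷ : (P : Path D) (𝒫 : List (Path D)) → Stable D (Ends 𝒫) →
    (∀ Q → Q ∈ 𝒫 → ¬ Adjacent D (end P) (end Q)) → Stable D (Ends (P ∷ 𝒫))
  Stable-∷ P 𝒫 stable nonadj _ _ (_ , here refl , refl) (_ , here refl , refl) = Adjacent-irrefl (end P)
  Stable-∷ P 𝒫 stable nonadj _ _ (_ , here refl , refl) (Q , there Q∈ , refl) = nonadj Q Q∈
  Stable-∷ P 𝒫 stable nonadj _ _ (Q , there Q∈ , refl) (_ , here refl , refl) =
    nonadj Q Q∈ ∘ Adjacent-sym (end Q) (end P)
  Stable-∷ P 𝒫 stable nonadj u v (Q , there Q∈ , Qu) (Q′ , there Q′∈ , Q′v) =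
    stable u v (Q , Q∈ , Qu) (Q′ , Q′∈ , Q′v)

  ends-stable-or-arc : (𝒫 : List (Path D)) → Stable D (Ends 𝒫) ⊎ ArcBetweenEnds 𝒫
  ends-stable-or-arc [] = inj₁ λ { _ _ (_ , () , _) }
  ends-stable-or-arc (P ∷ 𝒫) with ends-stable-or-arc 𝒫
  ... | inj₂ record { P = P₁ ; Q = Q₁ ; others = others ; split = split ; arcPQ = arcPQ } =
    inj₂ record { P = P₁ ; Q = Q₁ ; others = P ∷ others ; arcPQ = arcPQ
                ; split = ↭-trans (prep P split) (↭-sym (shift P (P₁ ∷ Q₁ ∷ []) others)) }
  ... | inj₁ stable with any? (λ Q → (arc D (end P) (end Q) ∨ arc D (end Q) (end P)) ≟ true) 𝒫
  ...   | no nonadj = inj₁ (Stable-∷ P 𝒫 stable (λ Q Q∈ adj → nonadj (lose Q∈ adj)))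
  ...   | yes adj with Q , Q∈ , adjPQ ← find adj with others , 𝒫↭ ← ∈⇒↭∷ Q∈
                  with Adjacent⇒Arc (end P) (end Q) adjPQ
  ...     | inj₁ arcPQ = inj₂ record { P = P ; Q = Q ; others = others ; split = prep P 𝒫↭ ; arcPQ = arcPQ }
  ...     | inj₂ arcQP = inj₂ record { P = Q ; Q = P ; others = others ; arcPQ = arcQP
                                     ; split = ↭-trans (prep P 𝒫↭) (swap P Q ↭-refl) }

vertices : {D : Digraph} → List (Path D) → List (Vertex D)
vertices 𝒫 = concat (map verts 𝒫)

module _ {D : Digraph} {𝒫 others : List (Path D)} {P Q : Path D} (split : 𝒫 ↭ P ∷ Q ∷ others) where

  Unique-split : IsPathPartition D 𝒫 → Unique (verts P ++ verts Q ++ vertices others)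
  Unique-split (unique , _) = Unique-resp-↭ (concatMap-↭ verts split) unique

  Unique-merged : IsPathPartition D 𝒫 → Unique (verts P ++ verts Q)
  Unique-merged part =
    Unique-++⁻ˡ (verts P ++ verts Q) (subst Unique (sym (++-assoc (verts P) (verts Q) _)) (Unique-split part))

  ∈-split : ∀ {S} → S ∈ P ∷ Q ∷ others → S ∈ 𝒫
  ∈-split = ∈-resp-↭ (↭-sym split)

  module _ (R : Path D) (R↭ : verts R ↭ verts P ++ verts Q) where

    vertices-replace : vertices (R ∷ others) ↭ vertices 𝒫
    vertices-replace = ↭-trans (++⁺ʳ (vertices others) R↭)
      (↭-trans (↭-reflexive (++-assoc (verts P) (verts Q) _)) (↭-sym (concatMap-↭ verts split)))

    IsPathPartition-replace : IsPathPartition D 𝒫 → IsPathPartition D (R ∷ others)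
    IsPathPartition-replace (unique , covers) =
      Unique-resp-↭ (↭-sym vertices-replace) unique , λ v → ∈-resp-↭ (↭-sym vertices-replace) (covers v)

    Ends-replace-⊆ : end R ≡ end Q → SubsetOf D (Ends (R ∷ others)) (Ends 𝒫)
    Ends-replace-⊆ endR v (_ , here refl , Rv) = Q , ∈-split (there (here refl)) , trans (sym endR) Rv
    Ends-replace-⊆ endR v (S , there S∈ , Sv) = S , ∈-split (there (there S∈)) , Sv

    end-∉-Ends-replace : IsPathPartition D 𝒫 → end R ≡ end Q → Arc D (end P) (end Q) →
      ¬ Ends (R ∷ others) (end P)
    end-∉-Ends-replace _ endR arcPQ (_ , here refl , RP) =
      Arc-irrefl {D = D} (subst (Arc D (end P)) (trans (sym endR) RP) arcPQ)
    end-∉-Ends-replace part _ _ (S , there S∈ , SP) =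
      Unique-++⇒Disjoint (verts P) (Unique-split part)
        (lastOf-∈ (start P) (rest P) ,
         ∈-++⁺ʳ (verts Q) (∈-concat⁺′ (subst (_∈ verts S) SP (lastOf-∈ (start S) (rest S))) (∈-map⁺ verts S∈)))

    module _ (k : ℕ) where

      norm-split : norm k 𝒫 ≡ (order P ⊓ k + order Q ⊓ k) + norm k others
      norm-split = trans (sum-↭ (map⁺ (λ S → order S ⊓ k) split)) (sym (+-assoc (order P ⊓ k) _ _))

      norm-replace-≤ : norm k (R ∷ others) ≤ norm k 𝒫
      norm-replace-≤ = subst (norm k (R ∷ others) ≤_) (sym norm-split) (+-monoˡ-≤ (norm k others) R⊓k≤)
        where
        R⊓k≤ : order R ⊓ k ≤ order P ⊓ k + order Q ⊓ k
        R⊓k≤ = subst (λ m → m ⊓ k ≤ order P ⊓ k + order Q ⊓ k)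
                     (sym (trans (↭-length R↭) (length-++ (verts P))))
                     (⊓-subadditive (order P) (order Q) k)

      Orthogonal-replace : norm k (R ∷ others) ≡ norm k 𝒫 →
        (C : PartialColoring D k) → Orthogonal (R ∷ others) C → Orthogonal 𝒫 C
      Orthogonal-replace norm≡ C (metR ∷ metOthers) =
        let metP , metQ = +-squeeze (classesMet-≤ C P) (classesMet-≤ C Q) tight
        in All-resp-↭ (↭-sym split) (metP ∷ metQ ∷ metOthers)
        where
        open ≤-Reasoning
        tight : order P ⊓ k + order Q ⊓ k ≤ classesMet C P + classesMet C Q
        tight = begin
          order P ⊓ k + order Q ⊓ k
            ≡⟨ +-cancelʳ-≡ (norm k others) _ _ (trans (sym norm-split) (sym norm≡)) ⟩
          order R ⊓ k                           ≡⟨ sym metR ⟩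
          classesMetIn C (verts R)              ≡⟨ classesMetIn-↭ C R↭ ⟩
          classesMetIn C (verts P ++ verts Q)   ≤⟨ classesMetIn-++ C (verts P) (verts Q) ⟩
          classesMet C P + classesMet C Q       ∎

module _ {D : Digraph} (isc : InSemicomplete D) (k : ℕ) where

  Improves : List (Path D) → List (Path D) → Set
  Improves 𝒬 𝒫 =
    (norm k 𝒬 < norm k 𝒫 × ProperSubsetOf D (Ends 𝒬) (Ends 𝒫))
    ⊎ (norm k 𝒬 ≡ norm k 𝒫 × SubsetOf D (Ends 𝒬) (Ends 𝒫) × Stable D (Ends 𝒬)
       × (∀ (C : PartialColoring D k) → Orthogonal 𝒬 C → Orthogonal 𝒫 C))

  Improves-resp-≡ : {𝒫 𝒫′ 𝒬 : List (Path D)} →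
    norm k 𝒫′ ≡ norm k 𝒫 → SubsetOf D (Ends 𝒫′) (Ends 𝒫) →
    (∀ (C : PartialColoring D k) → Orthogonal 𝒫′ C → Orthogonal 𝒫 C) →
    Improves 𝒬 𝒫′ → Improves 𝒬 𝒫
  Improves-resp-≡ norm≡ ⊆𝒫 _ (inj₁ (norm< , ⊆𝒫′ , v , v∈ , v∉)) =
    inj₁ (subst (_ <_) norm≡ norm< , (λ u → ⊆𝒫 u ∘ ⊆𝒫′ u) , v , ⊆𝒫 v v∈ , v∉)
  Improves-resp-≡ norm≡ ⊆𝒫 orth (inj₂ (norm≡′ , ⊆𝒫′ , stable , orth′)) =
    inj₂ (trans norm≡′ norm≡ , (λ u → ⊆𝒫 u ∘ ⊆𝒫′ u) , stable , λ C → orth C ∘ orth′ C)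

  improve : (𝒫 : List (Path D)) → Acc _<_ (length 𝒫) → IsPathPartition D 𝒫 →
    ∃[ 𝒬 ] (IsPathPartition D 𝒬 × Improves 𝒬 𝒫)
  improve 𝒫 (acc shorter) part with ends-stable-or-arc 𝒫
  ... | inj₁ stable = 𝒫 , part , inj₂ (refl , (λ _ e → e) , stable , λ _ o → o)
  ... | inj₂ record { P = P ; Q = Q ; others = others ; split = split ; arcPQ = arcPQ }
      with R , R↭ , endR ← mergePaths isc P Q (Unique-merged split part) arcPQ
      with m≤n⇒m<n∨m≡n (norm-replace-≤ split R R↭ k)
  ... | inj₁ norm< =
    R ∷ others , IsPathPartition-replace split R R↭ part ,
    inj₁ (norm< , Ends-replace-⊆ split R R↭ endR ,
          end P , (P , ∈-split split (here refl) , refl) , end-∉-Ends-replace split R R↭ part endR arcPQ)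
  ... | inj₂ norm≡ =
    let 𝒬 , part𝒬 , improves = improve (R ∷ others) (shorter (≤-reflexive (sym (↭-length split))))
                                        (IsPathPartition-replace split R R↭ part)
    in 𝒬 , part𝒬 ,
       Improves-resp-≡ norm≡ (Ends-replace-⊆ split R R↭ endR) (Orthogonal-replace split R R↭ k norm≡) improves

-- The argument does not need k ≥ 1.
lemma2p1 : (D : Digraph) → InSemicomplete D → (k : ℕ) → 1 ≤ k →
    (𝒫 : List (Path D)) → IsPathPartition D 𝒫 →
    ∃[ 𝒬 ] (IsPathPartition D 𝒬 ×
    ((norm k 𝒬 < norm k 𝒫 × ProperSubsetOf D (Ends 𝒬) (Ends 𝒫))
    ⊎ (norm k 𝒬 ≡ norm k 𝒫 × SubsetOf D (Ends 𝒬) (Ends 𝒫) × Stable D (Ends 𝒬)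
    × (∀ (C : PartialColoring D k) → Orthogonal 𝒬 C → Orthogonal 𝒫 C))))
lemma2p1 D isc k _ 𝒫 = improve isc k 𝒫 (<-wellFounded (length 𝒫))
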